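{- Let $G$ be a graph on $n$ vertices such that neither $G$ nor its complement $\overline{G}$ has an isolated vertex, and let $\alpha\in(0,1]$. Then $\mathrm{pd}_\alpha(G)+\mathrm{pd}_\alpha(\overline{G})\le \left\lceil \dfrac{\lfloor n/2\rfloor+2}{\lfloor 1/\alpha\rfloor}\right\rceil+1$.
   Context: All graphs are finite and simple. For a graph $G=(V,E)$ and $S\subseteq V$, $N[S]$ denotes the closed neighbourhood of $S$. For $0<\alpha\le 1$, a set $S\subseteq V$ is an $\alpha$-partial dominating set if $|N[S]|\ge \alpha|V|$; $\mathrm{pd}_\alpha(G)$ is the minimum size of an $\alpha$-partial dominating set.
   Formalization: The parameter α ranges over the rationals in $(0,1]$. -}

module Defs where

open import Data.Nat using (ℕ; zero; suc; _+_; _≤_; ⌊_/2⌋; _/_)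
open import Data.Bool using (Bool; true; false; not; _∧_; _∨_)
open import Data.Fin using (Fin)
open import Data.Fin.Properties using (_≟_)
open import Data.Fin.Subset using (Subset; Side; inside; outside; ∣_∣; _∈_)
open import Data.Fin.Subset.Properties using (_∈?_)
open import Data.Vec using (tabulate)
open import Data.Product using (Σ; ∃; _×_; _,_)
open import Data.Integer using (ℤ; +_; +[1+_]; -[1+_])
open import Data.Rational using (ℚ; _≤_; _*_; _/_; ↥_; ↧ₙ_)
open import Relation.Nullary.Decidable using (⌊_⌋)
open import Relation.Binary.PropositionalEquality using (_≡_)
import Data.List.Base as List
open import Data.Bool.ListAction using (any)

record Graph (n : ℕ) : Set where
  field
    adj   : Fin n → Fin n → Bool
    adj-sym : ∀ u v → adj u v ≡ adj v u
    adj-irrefl : ∀ v → adj v v ≡ false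
open Graph public

complement : ∀ {n} → Graph n → Graph n
complement {n} G = record { adj = cadj ; adj-sym = csym ; adj-irrefl = cirr }
  where
  open import Relation.Binary.PropositionalEquality using (refl; cong₂; sym)
  open import Relation.Nullary using (yes; no)
  cadj : Fin n → Fin n → Bool
  cadj u v = not (adj G u v) ∧ not ⌊ u ≟ v ⌋
  csym : ∀ u v → cadj u v ≡ cadj v u
  csym u v with u ≟ v | v ≟ u
  ... | yes _ | yes _ rewrite Graph.adj-sym G u v = refl
  ... | yes p | no q = Data.Empty.⊥-elim (q (sym p)) where import Data.Empty
  ... | no p | yes q = Data.Empty.⊥-elim (p (sym q)) where import Data.Empty
  ... | no _ | no _ rewrite Graph.adj-sym G u v = refl
  cirr : ∀ v → cadj v v ≡ false
  cirr v with v ≟ v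
  ... | yes _ = lemma (not (adj G v v))
    where lemma : ∀ b → (b ∧ false) ≡ false
          lemma true = refl
          lemma false = refl
  ... | no ¬p = Data.Empty.⊥-elim (¬p refl) where import Data.Empty

Isolated : ∀ {n} → Graph n → Fin n → Set
Isolated G v = ∀ u → adj G v u ≡ false

HasNoIsolatedVertex : ∀ {n} → Graph n → Set
HasNoIsolatedVertex {n} G = ∀ v → Σ (Fin n) λ u → adj G v u ≡ true

N[_]_ : ∀ {n} → Subset n → Graph n → Subset n
N[_]_ {n} S G = tabulate λ v →
  toSide (any (λ u → ⌊ u ∈? S ⌋ ∧ (⌊ u ≟ v ⌋ ∨ adj G u v)) (List.allFin n))
  where
  toSide : Bool → Side
  toSide true = inside
  toSide false = outside

ℕ→ℚ : ℕ → ℚ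
ℕ→ℚ k = (+ k) Data.Rational./ 1

IsPartialDom : ∀ {n} → ℚ → Graph n → Subset n → Set
IsPartialDom {n} α G S = (α * ℕ→ℚ n) Data.Rational.≤ ℕ→ℚ ∣ N[ S ] G ∣

IsPD : ∀ {n} → ℚ → Graph n → ℕ → Set
IsPD α G k =
  (∃ λ S → IsPartialDom α G S × ∣ S ∣ ≡ k) ×
  (∀ S → IsPartialDom α G S → k Data.Nat.≤ ∣ S ∣)

-- ⌊1/α⌋ for a rational α = p/q in lowest terms with p > 0: ⌊q/p⌋
-- (junk value 0 when α ≤ 0, never used)
floorRecip : ℚ → ℕ
floorRecip α with ↥ α
... | +[1+ p ] = (↧ₙ α) Data.Nat./ suc p
... | + zero = 0
... | -[1+ _ ] = 0

-- ⌈a / b⌉ for b ≥ 1 (junk value 0 for b = 0, never used)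
ceilDiv : ℕ → ℕ → ℕ
ceilDiv a zero = 0
ceilDiv a (suc b) = (a + b) Data.Nat./ suc b

{-# OPTIONS --safe #-}
module Submission where

-- Write m = ⌊1/α⌋. A set S is α-partial dominating as soon as n ≤ m·|N[S]|, and
-- Ore's theorem gives a dominating set of size ≤ ⌊n/2⌋ in G and in Ḡ, so pd ≤ ⌊n/2⌋ for both.
--
-- If m = 1 the bound reads ⌊n/2⌋ + 3, which is clear unless pd(G), pd(Ḡ) ≥ 4. Then
-- pd(Ḡ) = c + 1 means that no c vertices dominate Ḡ, i.e. every c vertices have a common
-- closed neighbour in G; one such vertex per block of a partition of V into k blocks of
-- size ≤ c dominates G, so pd(G) ≤ k whenever n ≤ kc, which rules out a larger sum.
--
-- If m ≥ 2, for any vertex v one of N_G[v], N_Ḡ[v] has at least n/2 vertices, so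
-- pd(G) ≤ 1 or pd(Ḡ) ≤ 1. Splitting a dominating set of size ≤ ⌊n/2⌋ of the other graph
-- into m blocks of size ≤ ⌈(⌊n/2⌋+2)/m⌉, the neighbourhoods of the blocks cover V, so by
-- pigeonhole one block T has m·|N[T]| ≥ n and is α-partial dominating.

open import Defs
open import Data.Bool using (Bool; true; false; T; _∧_; _∨_)
open import Data.Bool.ListAction using (any)
open import Data.Empty using (⊥-elim)
open import Data.Fin using (Fin; zero; suc)
open import Data.Fin.Properties using (_≟_; all?; any?; ¬∀⟶∃¬)
open import Data.Fin.Subset
  using (Subset; inside; outside; _∈_; _∉_; _⊆_; _⊂_; ∣_∣; ⁅_⁆; _∪_; ∁; _-_; ⊤)
  renaming (⊥ to ∅)
open import Data.Fin.Subset.Properties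
  using (_∈?_; ∈⊤; ∣⊥∣≡0; ∣⊤∣≡n; ∣∁p∣≡n∸∣p∣; ∣⁅x⁆∣≡1; p⊆q⇒∣p∣≤∣q∣; x∈⁅x⁆; x∈p∪q⁺; x∈p∪q⁻;
         ∪-assoc; ∪-identityˡ; x∉p⇒x∈∁p; x∈p∧x≢y⇒x∈p-y; x∈p⇒p-x⊂p)
open import Data.Fin.Subset.Induction using (⊂-wellFounded)
open import Data.Integer as ℤ using (+[1+_]; -[1+_]; +≤+)
import Data.Integer.Properties as ℤ
open import Data.List using (List; []; _∷_; _++_; length; take; drop; map; allFin)
open import Data.List.Properties using (length-take; length-drop; take++drop≡id; length-map; length-tabulate)
open import Data.List.Membership.Propositional using (find; lose) renaming (_∈_ to _∈ₗ_)
open import Data.List.Membership.Propositional.Properties using (∈-allFin; ∈-map⁺)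
open import Data.List.Relation.Unary.All as All using (All; []; _∷_)
open import Data.List.Relation.Unary.All.Properties using (++⁺)
open import Data.List.Relation.Unary.Any using (Any; here; there; satisfied)
open import Data.List.Relation.Unary.Any.Properties using (any⁺; any⁻)
open import Data.Nat using (ℕ; zero; suc; _+_; _*_; _∸_; _≤_; z≤n; s≤s; s≤s⁻¹; NonZero; ⌊_/2⌋)
open import Data.Nat.DivMod using (_/_; _%_; m/n*n≤m; m≡m%n+[m/n]*n; m%n<n; n/1≡n; m≥n⇒m/n>0)
open import Data.Nat.Properties hiding (_≟_)
open import Data.Nat.Tactic.RingSolver using (solve-∀)
open import Data.Product using (∃; _×_; _,_; proj₁; proj₂)
open import Data.Rational as ℚ using (ℚ; mkℚ; 0ℚ; 1ℚ; toℚᵘ; *<*; *≤*)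
import Data.Rational
import Data.Rational.Properties as ℚ
open import Data.Rational.Unnormalised as ℚᵘ using (mkℚᵘ)
import Data.Rational.Unnormalised.Properties as ℚᵘ
open import Data.Sum using (_⊎_; inj₁; inj₂; [_,_]′)
open import Data.Unit using (tt)
open import Data.Vec using ([]; _∷_; here; there; lookup; tabulate)
open import Data.Vec.Properties using (lookup∘tabulate; []=⇒lookup; lookup⇒[]=)
open import Induction.WellFounded using (Acc; acc)
open import Relation.Nullary using (¬_; yes; no; _×-dec_)
open import Relation.Nullary.Decidable using (Dec; ⌊_⌋)
open import Relation.Binary.PropositionalEquality

n≤1+⌊n/2⌋+⌊n/2⌋ : ∀ n → n ≤ suc (⌊ n /2⌋ + ⌊ n /2⌋)
n≤1+⌊n/2⌋+⌊n/2⌋ zero          = z≤n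
n≤1+⌊n/2⌋+⌊n/2⌋ (suc zero)    = s≤s z≤n
n≤1+⌊n/2⌋+⌊n/2⌋ (suc (suc n)) =
  s≤s (s≤s (≤-trans (n≤1+⌊n/2⌋+⌊n/2⌋ n) (≤-reflexive (sym (+-suc _ _)))))

n≤[3+a]*[3+b] : ∀ {n h} a b → n ≤ suc (h + h) → h ≤ 4 + (a + b) → n ≤ (3 + a) * (3 + b)
n≤[3+a]*[3+b] {n} {h} a b n≤2h+1 h≤ = begin
  n                                         ≤⟨ n≤2h+1 ⟩
  suc (h + h)                               ≤⟨ s≤s (+-mono-≤ h≤ h≤) ⟩
  suc (4 + s + (4 + s))                     ≤⟨ m≤m+n _ (a * b + s) ⟩
  suc (4 + s + (4 + s)) + (a * b + s)       ≡⟨ expand a b ⟩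
  (3 + a) * (3 + b)                         ∎
  where
  open ≤-Reasoning
  s = a + b
  expand : ∀ a b → suc (4 + (a + b) + (4 + (a + b))) + (a * b + (a + b)) ≡ (3 + a) * (3 + b)
  expand = solve-∀

4+a+[4+b]≤h+2+1 : ∀ {h} a b → 5 + (a + b) ≤ h → 4 + a + (4 + b) ≤ h + 2 + 1
4+a+[4+b]≤h+2+1 {h} a b 5+a+b≤h = begin
  4 + a + (4 + b)        ≡⟨ regroup a b ⟩
  5 + (a + b) + 3        ≤⟨ +-monoˡ-≤ 3 5+a+b≤h ⟩
  h + 3                  ≡⟨ +-assoc h 2 1 ⟨
  h + 2 + 1              ∎
  where
  open ≤-Reasoning
  regroup : ∀ a b → 4 + a + (4 + b) ≡ 5 + (a + b) + 3
  regroup = solve-∀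

ceilDiv[a,1]≡a : ∀ a → ceilDiv a 1 ≡ a
ceilDiv[a,1]≡a a = trans (n/1≡n (a + 0)) (+-identityʳ a)

a≤ceilDiv[a,m]*m : ∀ a {m} → 1 ≤ m → a ≤ ceilDiv a m * m
a≤ceilDiv[a,m]*m a {suc b} _ = +-cancelʳ-≤ b a (q * suc b) (begin
  a + b                        ≡⟨ m≡m%n+[m/n]*n (a + b) (suc b) ⟩
  (a + b) % suc b + q * suc b  ≤⟨ +-monoˡ-≤ (q * suc b) (s≤s⁻¹ (m%n<n (a + b) (suc b))) ⟩
  b + q * suc b                ≡⟨ +-comm b (q * suc b) ⟩
  q * suc b + b                ∎)
  where
  open ≤-Reasoning
  q = (a + b) / suc b

m≤[o/n]*p⇒n*m≤o*p : ∀ n o {m p} .{{_ : NonZero n}} → m ≤ o / n * p → n * m ≤ o * p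
m≤[o/n]*p⇒n*m≤o*p n o {m} {p} m≤[o/n]*p = begin
  n * m            ≤⟨ *-monoʳ-≤ n m≤[o/n]*p ⟩
  n * (o / n * p)  ≡⟨ *-assoc n (o / n) p ⟨
  n * (o / n) * p  ≡⟨ cong (_* p) (*-comm n (o / n)) ⟩
  o / n * n * p    ≤⟨ *-monoˡ-≤ p (m/n*n≤m o n) ⟩
  o * p            ∎
  where open ≤-Reasoning

1≤floorRecip : ∀ α → 0ℚ ℚ.< α → α ℚ.≤ 1ℚ → 1 ≤ floorRecip α
1≤floorRecip (mkℚ +[1+ p ] d _) _ (*≤* α≤1) =
  m≥n⇒m/n>0 {suc d} {suc p}
    (ℤ.drop‿+≤+ (subst₂ ℤ._≤_ (ℤ.*-identityʳ (ℤ.+ suc p)) (ℤ.*-identityˡ (ℤ.+ suc d)) α≤1))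
1≤floorRecip (mkℚ (ℤ.+ zero) _ _) (*<* (ℤ.+<+ ()))
1≤floorRecip (mkℚ -[1+ _ ] _ _) (*<* ())

toℚᵘ-ℕ→ℚ : ∀ k → toℚᵘ (ℕ→ℚ k) ℚᵘ.≃ mkℚᵘ (ℤ.+ k) 0
toℚᵘ-ℕ→ℚ k = ℚ.toℚᵘ-fromℚᵘ (mkℚᵘ (ℤ.+ k) 0)

n≤floorRecip*k⇒α*n≤k : ∀ α → 0ℚ ℚ.< α → ∀ {n k} → n ≤ floorRecip α * k → α ℚ.* ℕ→ℚ n ℚ.≤ ℕ→ℚ k
n≤floorRecip*k⇒α*n≤k α@(mkℚ +[1+ p ] d _) _ {n} {k} n≤mk = ℚ.toℚᵘ-cancel-≤ (begin
  toℚᵘ (α ℚ.* ℕ→ℚ n)          ≃⟨ ℚ.toℚᵘ-homo-* α (ℕ→ℚ n) ⟩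
  toℚᵘ α ℚᵘ.* toℚᵘ (ℕ→ℚ n)    ≃⟨ ℚᵘ.*-congˡ {toℚᵘ α} (toℚᵘ-ℕ→ℚ n) ⟩
  toℚᵘ α ℚᵘ.* mkℚᵘ (ℤ.+ n) 0  ≤⟨ ℚᵘ.*≤* (subst₂ ℤ._≤_ lhs rhs (+≤+ (m≤[o/n]*p⇒n*m≤o*p (suc p) (suc d) n≤mk))) ⟩
  mkℚᵘ (ℤ.+ k) 0              ≃⟨ toℚᵘ-ℕ→ℚ k ⟨
  toℚᵘ (ℕ→ℚ k)                ∎)
  where
  open ℚᵘ.≤-Reasoning
  lhs : ℤ.+ (suc p * n) ≡ (+[1+ p ] ℤ.* ℤ.+ n) ℤ.* ℤ.+ 1
  lhs = trans (ℤ.pos-* (suc p) n) (sym (ℤ.*-identityʳ (+[1+ p ] ℤ.* ℤ.+ n)))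
  rhs : ℤ.+ (suc d * k) ≡ ℤ.+ k ℤ.* ℤ.+ (suc d * 1)
  rhs = trans (cong ℤ.+_ (trans (*-comm (suc d) k) (cong (k *_) (sym (*-identityʳ (suc d))))))
              (ℤ.pos-* k (suc d * 1))
n≤floorRecip*k⇒α*n≤k (mkℚ (ℤ.+ zero) _ _) (*<* (ℤ.+<+ ()))
n≤floorRecip*k⇒α*n≤k (mkℚ -[1+ _ ] _ _) (*<* ())

∣p∪q∣≤∣p∣+∣q∣ : ∀ {n} (p q : Subset n) → ∣ p ∪ q ∣ ≤ ∣ p ∣ + ∣ q ∣
∣p∪q∣≤∣p∣+∣q∣ []            []            = z≤n
∣p∪q∣≤∣p∣+∣q∣ (inside ∷ p)  (inside ∷ q)  =
  s≤s (≤-trans (∣p∪q∣≤∣p∣+∣q∣ p q) (≤-trans (n≤1+n _) (≤-reflexive (sym (+-suc _ _)))))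
∣p∪q∣≤∣p∣+∣q∣ (inside ∷ p)  (outside ∷ q) = s≤s (∣p∪q∣≤∣p∣+∣q∣ p q)
∣p∪q∣≤∣p∣+∣q∣ (outside ∷ p) (inside ∷ q)  =
  ≤-trans (s≤s (∣p∪q∣≤∣p∣+∣q∣ p q)) (≤-reflexive (sym (+-suc _ _)))
∣p∪q∣≤∣p∣+∣q∣ (outside ∷ p) (outside ∷ q) = ∣p∪q∣≤∣p∣+∣q∣ p q

∀x∈p⇒n≤∣p∣ : ∀ {n} {p : Subset n} → (∀ x → x ∈ p) → n ≤ ∣ p ∣
∀x∈p⇒n≤∣p∣ {n} ∀x∈p = ≤-trans (≤-reflexive (sym (∣⊤∣≡n n))) (p⊆q⇒∣p∣≤∣q∣ {p = ⊤} (λ {x} _ → ∀x∈p x))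

∣p∣≤⌊n/2⌋⊎∣∁p∣≤⌊n/2⌋ : ∀ {n} (p : Subset n) → ∣ p ∣ ≤ ⌊ n /2⌋ ⊎ ∣ ∁ p ∣ ≤ ⌊ n /2⌋
∣p∣≤⌊n/2⌋⊎∣∁p∣≤⌊n/2⌋ {n} p with ∣ p ∣ ≤? ⌊ n /2⌋
... | yes ∣p∣≤h = inj₁ ∣p∣≤h
... | no ∣p∣≰h = inj₂ (begin
  ∣ ∁ p ∣          ≡⟨ ∣∁p∣≡n∸∣p∣ p ⟩
  n ∸ ∣ p ∣        ≤⟨ ∸-monoʳ-≤ n (≰⇒> ∣p∣≰h) ⟩
  n ∸ suc ⌊ n /2⌋  ≤⟨ m≤n+o⇒m∸n≤o n (suc ⌊ n /2⌋) (n≤1+⌊n/2⌋+⌊n/2⌋ n) ⟩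
  ⌊ n /2⌋          ∎)
  where open ≤-Reasoning

fromList : ∀ {n} → List (Fin n) → Subset n
fromList []       = ∅
fromList (x ∷ xs) = ⁅ x ⁆ ∪ fromList xs

∣fromList∣≤length : ∀ {n} (xs : List (Fin n)) → ∣ fromList xs ∣ ≤ length xs
∣fromList∣≤length {n} []       = ≤-reflexive (∣⊥∣≡0 n)
∣fromList∣≤length (x ∷ xs) = begin
  ∣ ⁅ x ⁆ ∪ fromList xs ∣       ≤⟨ ∣p∪q∣≤∣p∣+∣q∣ ⁅ x ⁆ (fromList xs) ⟩
  ∣ ⁅ x ⁆ ∣ + ∣ fromList xs ∣   ≡⟨ cong (_+ ∣ fromList xs ∣) (∣⁅x⁆∣≡1 x) ⟩
  suc ∣ fromList xs ∣           ≤⟨ s≤s (∣fromList∣≤length xs) ⟩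
  suc (length xs)               ∎
  where open ≤-Reasoning

∈fromList⁺ : ∀ {n} {x : Fin n} {xs} → x ∈ₗ xs → x ∈ fromList xs
∈fromList⁺ (here refl) = x∈p∪q⁺ (inj₁ (x∈⁅x⁆ _))
∈fromList⁺ (there x∈xs) = x∈p∪q⁺ (inj₂ (∈fromList⁺ x∈xs))

fromList-++ : ∀ {n} (xs ys : List (Fin n)) → fromList (xs ++ ys) ≡ fromList xs ∪ fromList ys
fromList-++ []       ys = sym (∪-identityˡ (fromList ys))
fromList-++ (x ∷ xs) ys =
  trans (cong (⁅ x ⁆ ∪_) (fromList-++ xs ys)) (sym (∪-assoc ⁅ x ⁆ (fromList xs) (fromList ys)))

toList : ∀ {n} → Subset n → List (Fin n)
toList []            = []
toList (inside ∷ p)  = zero ∷ map suc (toList p)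
toList (outside ∷ p) = map suc (toList p)

length-toList : ∀ {n} (p : Subset n) → length (toList p) ≡ ∣ p ∣
length-toList []            = refl
length-toList (inside ∷ p)  = cong suc (trans (length-map suc (toList p)) (length-toList p))
length-toList (outside ∷ p) = trans (length-map suc (toList p)) (length-toList p)

∈toList⁺ : ∀ {n} {p : Subset n} {x} → x ∈ p → x ∈ₗ toList p
∈toList⁺ {p = inside ∷ p}  here       = here refl
∈toList⁺ {p = inside ∷ p}  (there x∈p) = there (∈-map⁺ suc (∈toList⁺ x∈p))
∈toList⁺ {p = outside ∷ p} (there x∈p) = ∈-map⁺ suc (∈toList⁺ x∈p)

length-take≤ : ∀ {A : Set} c (xs : List A) → length (take c xs) ≤ c
length-take≤ c xs = ≤-trans (≤-reflexive (length-take c xs)) (m⊓n≤m c (length xs))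

length-drop≤ : ∀ {A : Set} c {k} (xs : List A) → length xs ≤ c + k → length (drop c xs) ≤ k
length-drop≤ c xs len = ≤-trans (≤-reflexive (length-drop c xs)) (m≤n+o⇒m∸n≤o (length xs) c len)

cover-by-blocks : ∀ {A B : Set} (R : B → A → Set) c →
  (∀ T → length T ≤ c → ∃ λ w → All (R w) T) →
  ∀ k xs → length xs ≤ k * c → ∃ λ W → length W ≡ k × All (λ x → Any (λ w → R w x) W) xs
cover-by-blocks R c cover zero    []  _   = [] , refl , []
cover-by-blocks R c cover (suc k) xs  len =
  let w , Rw              = cover (take c xs) (length-take≤ c xs)
      W , len-W , covered = cover-by-blocks R c cover k (drop c xs) (length-drop≤ c xs len)
  in w ∷ W , cong suc len-W ,
     subst (All _) (take++drop≡id c xs) (++⁺ (All.map here Rw) (All.map there covered))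

subadditive-pigeonhole : ∀ {A : Set} (g : List A → ℕ) →
  (∀ xs ys → g (xs ++ ys) ≤ g xs + g ys) →
  ∀ c k xs → length xs ≤ suc k * c → ∃ λ T → length T ≤ c × g xs ≤ suc k * g T
subadditive-pigeonhole g sub c zero    xs len =
  xs , ≤-trans len (≤-reflexive (+-identityʳ c)) , ≤-reflexive (sym (+-identityʳ (g xs)))
subadditive-pigeonhole g sub c (suc k) xs len =
  let T , len-T , g-rest = subadditive-pigeonhole g sub c k (drop c xs) (length-drop≤ c xs len)
      g-split = ≤-trans (≤-reflexive (cong g (sym (take++drop≡id c xs)))) (sub (take c xs) (drop c xs))
  in [ (λ g-first≤g-T → T , len-T , ≤-trans g-split (+-mono-≤ g-first≤g-T g-rest))
     , (λ g-T≤g-first → take c xs , length-take≤ c xs ,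
          ≤-trans g-split (+-monoʳ-≤ (g (take c xs)) (≤-trans g-rest (*-monoʳ-≤ (suc k) g-T≤g-first))))
     ]′ (≤-total (g (take c xs)) (g T))

-- Closed neighbourhoods and domination

Dominates : ∀ {n} → Graph n → Fin n → Fin n → Set
Dominates H u v = u ≡ v ⊎ adj H u v ≡ true

Dominates-sym : ∀ {n} {H : Graph n} {u v} → Dominates H u v → Dominates H v u
Dominates-sym         (inj₁ u≡v) = inj₁ (sym u≡v)
Dominates-sym {H = H} (inj₂ uv)  = inj₂ (trans (adj-sym H _ _) uv)

adj⇒≢ : ∀ {n} {H : Graph n} {u v} → adj H u v ≡ true → u ≢ v
adj⇒≢ {H = H} uv refl with trans (sym uv) (adj-irrefl H _)
... | ()

Dominates⊎Dominates-complement : ∀ {n} (G : Graph n) u v → Dominates G u v ⊎ Dominates (complement G) u v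
Dominates⊎Dominates-complement G u v with u ≟ v | adj G u v
... | yes u≡v | _     = inj₁ (inj₁ u≡v)
... | no _    | true  = inj₁ (inj₂ refl)
... | no _    | false = inj₂ (inj₂ refl)

-- N[_]_ turns Booleans into sides by a function local to Defs that cannot be named here,
-- so membership in N[ S ] H is read off through lookup and a with-abstraction over any.
private
  closedAdj : ∀ {n} → Subset n → Graph n → Fin n → Fin n → Bool
  closedAdj S H v u = ⌊ u ∈? S ⌋ ∧ (⌊ u ≟ v ⌋ ∨ adj H u v)

  lookup-tabulate : ∀ {n} {A : Set} {f : Fin n → A} {v x} → lookup (tabulate f) v ≡ x → f v ≡ x
  lookup-tabulate {f = f} {v} = trans (sym (lookup∘tabulate f v))

  closedAdj-sound : ∀ {n} {S : Subset n} {H v u} → T (closedAdj S H v u) → u ∈ S × Dominates H u v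
  closedAdj-sound {S = S} {H} {v} {u} t with u ∈? S | u ≟ v | adj H u v
  closedAdj-sound _  | yes u∈S | yes u≡v | _     = u∈S , inj₁ u≡v
  closedAdj-sound _  | yes u∈S | no _    | true  = u∈S , inj₂ refl
  closedAdj-sound () | yes _   | no _    | false
  closedAdj-sound () | no _    | _       | _

  closedAdj-complete : ∀ {n} {S : Subset n} {H v u} → u ∈ S → Dominates H u v → T (closedAdj S H v u)
  closedAdj-complete {S = S} {H} {v} {u} u∈S u→v with u ∈? S | u ≟ v | u→v
  ... | no u∉S | _       | _          = u∉S u∈S
  ... | yes _  | yes _   | _          = tt
  ... | yes _  | no u≢v  | inj₁ u≡v   = ⊥-elim (u≢v u≡v)
  ... | yes _  | no _    | inj₂ uv    = subst T (sym uv) tt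

∈N[]⁺ : ∀ {n} {S : Subset n} {H u v} → u ∈ S → Dominates H u v → v ∈ N[ S ] H
∈N[]⁺ {n} {S} {H} {u} {v} u∈S u→v with lookup (N[ S ] H) v in e
... | true  = lookup⇒[]= v (N[ S ] H) e
... | false with any (closedAdj S H v) (allFin n) | lookup-tabulate {n} {v = v} e
                | any⁺ (closedAdj S H v) (lose (∈-allFin u) (closedAdj-complete {H = H} u∈S u→v))
...   | true  | () | _
...   | false | _  | ()

∈N[]⁻ : ∀ {n} {S : Subset n} {H v} → v ∈ N[ S ] H → ∃ λ u → u ∈ S × Dominates H u v
∈N[]⁻ {n} {S} {H} {v} v∈N
  with any (closedAdj S H v) (allFin n) in e | lookup-tabulate {n} {v = v} ([]=⇒lookup v∈N)
... | true  | _  =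
  Data.Product.map₂ (closedAdj-sound {H = H}) (satisfied (any⁻ _ (allFin n) (subst T (sym e) tt)))
... | false | ()

Dominating : ∀ {n} → Graph n → Subset n → Set
Dominating H S = ∀ v → v ∈ N[ S ] H

dominating? : ∀ {n} (H : Graph n) S → Dec (Dominating H S)
dominating? H S = all? (λ v → v ∈? N[ S ] H)

N[]-mono : ∀ {n} {H : Graph n} {S S′} → S ⊆ S′ → N[ S ] H ⊆ N[ S′ ] H
N[]-mono {H = H} S⊆S′ v∈N with ∈N[]⁻ {H = H} v∈N
... | u , u∈S , u→v = ∈N[]⁺ {H = H} (S⊆S′ u∈S) u→v

N[]-∪ : ∀ {n} {H : Graph n} {S S′} → N[ S ∪ S′ ] H ⊆ N[ S ] H ∪ N[ S′ ] H
N[]-∪ {H = H} {S} {S′} v∈N with ∈N[]⁻ {H = H} v∈N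
... | u , u∈S∪S′ , u→v with x∈p∪q⁻ S S′ u∈S∪S′
...   | inj₁ u∈S  = x∈p∪q⁺ (inj₁ (∈N[]⁺ {H = H} u∈S u→v))
...   | inj₂ u∈S′ = x∈p∪q⁺ (inj₂ (∈N[]⁺ {H = H} u∈S′ u→v))

∣N[fromList]∣-subadditive : ∀ {n} (H : Graph n) xs ys →
  ∣ N[ fromList (xs ++ ys) ] H ∣ ≤ ∣ N[ fromList xs ] H ∣ + ∣ N[ fromList ys ] H ∣
∣N[fromList]∣-subadditive H xs ys = begin
  ∣ N[ fromList (xs ++ ys) ] H ∣                 ≡⟨ cong (λ S → ∣ N[ S ] H ∣) (fromList-++ xs ys) ⟩
  ∣ N[ fromList xs ∪ fromList ys ] H ∣           ≤⟨ p⊆q⇒∣p∣≤∣q∣ (N[]-∪ {H = H}) ⟩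
  ∣ N[ fromList xs ] H ∪ N[ fromList ys ] H ∣     ≤⟨ ∣p∪q∣≤∣p∣+∣q∣ (N[ fromList xs ] H) (N[ fromList ys ] H) ⟩
  ∣ N[ fromList xs ] H ∣ + ∣ N[ fromList ys ] H ∣ ∎
  where open ≤-Reasoning

n≤∣N[v]∣+∣N[v]-complement∣ : ∀ {n} (G : Graph n) v → n ≤ ∣ N[ ⁅ v ⁆ ] G ∣ + ∣ N[ ⁅ v ⁆ ] (complement G) ∣
n≤∣N[v]∣+∣N[v]-complement∣ G v =
  ≤-trans (∀x∈p⇒n≤∣p∣ covered) (∣p∪q∣≤∣p∣+∣q∣ (N[ ⁅ v ⁆ ] G) (N[ ⁅ v ⁆ ] (complement G)))
  where
  covered : ∀ u → u ∈ N[ ⁅ v ⁆ ] G ∪ N[ ⁅ v ⁆ ] (complement G)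
  covered u = x∈p∪q⁺ (Data.Sum.map (∈N[]⁺ {H = G} (x∈⁅x⁆ v)) (∈N[]⁺ {H = complement G} (x∈⁅x⁆ v))
                                   (Dominates⊎Dominates-complement G v u))

Dominating-mono : ∀ {n} {H : Graph n} {S S′} → S ⊆ S′ → Dominating H S → Dominating H S′
Dominating-mono {H = H} S⊆S′ domS v = N[]-mono {H = H} S⊆S′ (domS v)

-- Ore's bound

MinimalDominating : ∀ {n} → Graph n → Subset n → Set
MinimalDominating H D = Dominating H D × (∀ {v} → v ∈ D → ¬ Dominating H (D - v))

minimalDominating-acc : ∀ {n} (H : Graph n) {S} → Acc _⊂_ S → Dominating H S → ∃ (MinimalDominating H)
minimalDominating-acc H {S} (acc rs) domS with any? (λ v → v ∈? S ×-dec dominating? H (S - v))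
... | yes (v , v∈S , domS-v) = minimalDominating-acc H (rs (x∈p⇒p-x⊂p v∈S)) domS-v
... | no cannot-shrink       = S , domS , λ v∈S domS-v → cannot-shrink (_ , v∈S , domS-v)

minimalDominating : ∀ {n} (H : Graph n) → ∃ (MinimalDominating H)
minimalDominating H = minimalDominating-acc H (⊂-wellFounded ⊤) (λ v → ∈N[]⁺ {H = H} ∈⊤ (inj₁ refl))

dominatedOnlyBy : ∀ {n} {H : Graph n} {D v x} → x ∈ N[ D ] H → x ∉ N[ D - v ] H → Dominates H v x
dominatedOnlyBy {H = H} {v = v} x∈N x∉N with ∈N[]⁻ {H = H} x∈N
... | u , u∈D , u→x with u ≟ v
...   | yes refl = u→x
...   | no u≢v   = ⊥-elim (x∉N (∈N[]⁺ {H = H} (x∈p∧x≢y⇒x∈p-y u∈D u≢v) u→x))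

dominatedFromOutside : ∀ {n} {H : Graph n} {D v x} w → adj H w v ≡ true → Dominates H w x →
                       x ∉ N[ D - v ] H → v ∈ N[ ∁ D ] H
dominatedFromOutside {H = H} {D} w wv w→x x∉N with w ∈? D
... | yes w∈D = ⊥-elim (x∉N (∈N[]⁺ {H = H} (x∈p∧x≢y⇒x∈p-y w∈D (adj⇒≢ {H = H} wv)) w→x))
... | no w∉D  = ∈N[]⁺ {H = H} (x∉p⇒x∈∁p w∉D) (inj₂ wv)

-- For v in a minimal dominating set D, some x is dominated by v but by no other vertex of D.
-- If x = v, a neighbour of v lies outside D; otherwise x itself does.
∁-minimalDominating : ∀ {n} {H : Graph n} {D} → HasNoIsolatedVertex H → MinimalDominating H D →
                      Dominating H (∁ D)
∁-minimalDominating {n} {H} {D} noIso (domD , minD) v with v ∈? D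
... | no v∉D  = ∈N[]⁺ {H = H} (x∉p⇒x∈∁p v∉D) (inj₁ refl)
... | yes v∈D with ¬∀⟶∃¬ n _ (λ x → x ∈? N[ D - v ] H) (minD v∈D)
...   | x , x∉N with dominatedOnlyBy {H = H} (domD x) x∉N | noIso v
...     | inj₁ refl | y , vy = dominatedFromOutside {H = H} y yv (inj₂ yv) x∉N
  where yv = trans (adj-sym H y v) vy
...     | inj₂ vx   | _      = dominatedFromOutside {H = H} x (trans (adj-sym H x v) vx) (inj₁ refl) x∉N

ore : ∀ {n} {H : Graph n} → HasNoIsolatedVertex H → ∃ λ D → Dominating H D × ∣ D ∣ ≤ ⌊ n /2⌋
ore {H = H} noIso with minimalDominating H
... | D , minD with ∣p∣≤⌊n/2⌋⊎∣∁p∣≤⌊n/2⌋ D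
...   | inj₁ small = D , proj₁ minD , small
...   | inj₂ small = ∁ D , ∁-minimalDominating {H = H} noIso minD , small

-- Splitting dominating sets into blocks

dominating⇒large-neighbourhood : ∀ {n} (H : Graph n) {D} → Dominating H D → ∀ m c → 1 ≤ m →
                                 ∣ D ∣ ≤ m * c → ∃ λ T → ∣ T ∣ ≤ c × n ≤ m * ∣ N[ T ] H ∣
dominating⇒large-neighbourhood H {D} domD (suc k) c _ ∣D∣≤mc =
  let T , len-T , ∣N[D]∣≤ = subadditive-pigeonhole (λ xs → ∣ N[ fromList xs ] H ∣)
                              (∣N[fromList]∣-subadditive H) c k (toList D)
                              (≤-trans (≤-reflexive (length-toList D)) ∣D∣≤mc)
  in fromList T , ≤-trans (∣fromList∣≤length T) len-T ,
     ≤-trans (∀x∈p⇒n≤∣p∣ (Dominating-mono {H = H} (λ x∈D → ∈fromList⁺ (∈toList⁺ x∈D)) domD)) ∣N[D]∣≤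

∉N[complement]⇒Dominates : ∀ {n} {G : Graph n} {S w v} → w ∉ N[ S ] (complement G) → v ∈ S → Dominates G w v
∉N[complement]⇒Dominates {G = G} {w = w} {v} w∉N v∈S with Dominates⊎Dominates-complement G v w
... | inj₁ v→w = Dominates-sym {H = G} v→w
... | inj₂ v→w = ⊥-elim (w∉N (∈N[]⁺ {H = complement G} v∈S v→w))

complement-undominated⇒dominating : ∀ {n} (G : Graph n) c k → n ≤ k * c →
  (∀ T → ∣ T ∣ ≤ c → ¬ Dominating (complement G) T) → ∃ λ W → Dominating G W × ∣ W ∣ ≤ k
complement-undominated⇒dominating {n} G c k n≤kc undominated =
  let W , len-W , covered = cover-by-blocks (Dominates G) c dominator k (allFin n)
                              (≤-trans (≤-reflexive (length-tabulate (λ x → x))) n≤kc)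
  in fromList W , dominating covered , ≤-trans (∣fromList∣≤length W) (≤-reflexive len-W)
  where
  dominator : ∀ T → length T ≤ c → ∃ λ w → All (Dominates G w) T
  dominator T len-T with ¬∀⟶∃¬ n _ (λ v → v ∈? N[ fromList T ] (complement G))
                           (undominated (fromList T) (≤-trans (∣fromList∣≤length T) len-T))
  ... | w , w∉N = w , All.tabulate (λ v∈T → ∉N[complement]⇒Dominates {G = G} w∉N (∈fromList⁺ v∈T))
  dominating : ∀ {W} → All (λ v → Any (λ w → Dominates G w v) W) (allFin n) → Dominating G (fromList W)
  dominating covered v =
    let w , w∈W , w→v = find (All.lookup covered (∈-allFin v)) in ∈N[]⁺ {H = G} (∈fromList⁺ w∈W) w→v

-- Partial domination

module _ {α : ℚ} (0<α : 0ℚ ℚ.< α) (α≤1 : α ℚ.≤ 1ℚ) where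

  n≤floorRecip*∣N[S]∣⇒IsPartialDom : ∀ {n} (H : Graph n) S → n ≤ floorRecip α * ∣ N[ S ] H ∣ → IsPartialDom α H S
  n≤floorRecip*∣N[S]∣⇒IsPartialDom H S = n≤floorRecip*k⇒α*n≤k α 0<α

  Dominating⇒IsPartialDom : ∀ {n} (H : Graph n) S → Dominating H S → IsPartialDom α H S
  Dominating⇒IsPartialDom {n} H S domS = n≤floorRecip*∣N[S]∣⇒IsPartialDom H S (begin
    n                                  ≤⟨ ∀x∈p⇒n≤∣p∣ {p = N[ S ] H} domS ⟩
    ∣ N[ S ] H ∣                        ≡⟨ *-identityˡ ∣ N[ S ] H ∣ ⟨
    1 * ∣ N[ S ] H ∣                    ≤⟨ *-monoˡ-≤ ∣ N[ S ] H ∣ (1≤floorRecip α 0<α α≤1) ⟩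
    floorRecip α * ∣ N[ S ] H ∣         ∎)
    where open ≤-Reasoning

  pd≤∣Dominating∣ : ∀ {n} (H : Graph n) {k} S → IsPD α H k → Dominating H S → k ≤ ∣ S ∣
  pd≤∣Dominating∣ H S pd domS = proj₂ pd S (Dominating⇒IsPartialDom H S domS)

  pd≤⌊n/2⌋ : ∀ {n} (H : Graph n) {k} → HasNoIsolatedVertex H → IsPD α H k → k ≤ ⌊ n /2⌋
  pd≤⌊n/2⌋ H noIso pd =
    let D , domD , ∣D∣≤h = ore {H = H} noIso in ≤-trans (pd≤∣Dominating∣ H D pd domD) ∣D∣≤h

  pd-complement>c⇒pd≤k : ∀ {n} (G : Graph n) {k₁} c k → n ≤ k * c →
                         IsPD α (complement G) (suc c) → IsPD α G k₁ → k₁ ≤ k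
  pd-complement>c⇒pd≤k G c k n≤kc pd₂ pd₁ =
    let W , domW , ∣W∣≤k = complement-undominated⇒dominating G c k n≤kc
          (λ T ∣T∣≤c domT → 1+n≰n (≤-trans (pd≤∣Dominating∣ (complement G) T pd₂ domT) ∣T∣≤c))
    in ≤-trans (pd≤∣Dominating∣ G W pd₁ domW) ∣W∣≤k

  pd+pd-complement≤⌊n/2⌋+3-both≥4 : ∀ {n} (G : Graph n) {k₁ k₂} → 4 ≤ k₁ → 4 ≤ k₂ →
                           IsPD α G k₁ → IsPD α (complement G) k₂ → k₁ + k₂ ≤ ⌊ n /2⌋ + 2 + 1
  pd+pd-complement≤⌊n/2⌋+3-both≥4 {n} G (s≤s (s≤s (s≤s (s≤s {n = a} z≤n)))) (s≤s (s≤s (s≤s (s≤s {n = b} z≤n)))) pd₁ pd₂ =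
    [ contradiction , 4+a+[4+b]≤h+2+1 a b ]′ (≤-<-connex ⌊ n /2⌋ (4 + (a + b)))
    where
    contradiction : ⌊ n /2⌋ ≤ 4 + (a + b) → 4 + a + (4 + b) ≤ ⌊ n /2⌋ + 2 + 1
    contradiction h≤ = ⊥-elim (1+n≰n (pd-complement>c⇒pd≤k G (3 + b) (3 + a)
                                       (n≤[3+a]*[3+b] a b (n≤1+⌊n/2⌋+⌊n/2⌋ n) h≤) pd₂ pd₁))

  pd+pd-complement≤⌊n/2⌋+3 : ∀ {n} (G : Graph n) {k₁ k₂} →
    HasNoIsolatedVertex G → HasNoIsolatedVertex (complement G) →
    IsPD α G k₁ → IsPD α (complement G) k₂ → k₁ + k₂ ≤ ⌊ n /2⌋ + 2 + 1
  pd+pd-complement≤⌊n/2⌋+3 {n} G {k₁} {k₂} noG noḠ pd₁ pd₂ =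
    [ k₁-small
    , (λ 4≤k₁ → [ k₂-small , (λ 4≤k₂ → pd+pd-complement≤⌊n/2⌋+3-both≥4 G 4≤k₁ 4≤k₂ pd₁ pd₂) ]′ (≤-<-connex k₂ 3))
    ]′ (≤-<-connex k₁ 3)
    where
    open ≤-Reasoning
    k₁-small : k₁ ≤ 3 → k₁ + k₂ ≤ ⌊ n /2⌋ + 2 + 1
    k₁-small k₁≤3 = begin
      k₁ + k₂                ≤⟨ +-mono-≤ k₁≤3 (pd≤⌊n/2⌋ (complement G) noḠ pd₂) ⟩
      3 + ⌊ n /2⌋            ≡⟨ +-comm 3 ⌊ n /2⌋ ⟩
      ⌊ n /2⌋ + 3            ≡⟨ +-assoc ⌊ n /2⌋ 2 1 ⟨
      ⌊ n /2⌋ + 2 + 1        ∎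
    k₂-small : k₂ ≤ 3 → k₁ + k₂ ≤ ⌊ n /2⌋ + 2 + 1
    k₂-small k₂≤3 = begin
      k₁ + k₂                ≤⟨ +-mono-≤ (pd≤⌊n/2⌋ G noG pd₁) k₂≤3 ⟩
      ⌊ n /2⌋ + 3            ≡⟨ +-assoc ⌊ n /2⌋ 2 1 ⟨
      ⌊ n /2⌋ + 2 + 1        ∎

  Dominating⇒pd≤ : ∀ {n} (H : Graph n) {k D} c → Dominating H D → ∣ D ∣ ≤ floorRecip α * c →
                   IsPD α H k → k ≤ c
  Dominating⇒pd≤ H c domD ∣D∣≤mc pd =
    let T , ∣T∣≤c , large = dominating⇒large-neighbourhood H domD (floorRecip α) c
                              (1≤floorRecip α 0<α α≤1) ∣D∣≤mc
    in ≤-trans (proj₂ pd T (n≤floorRecip*∣N[S]∣⇒IsPartialDom H T large)) ∣T∣≤c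

  pd≤ceilDiv : ∀ {n} (H : Graph n) {k} → HasNoIsolatedVertex H → IsPD α H k →
               k ≤ ceilDiv (⌊ n /2⌋ + 2) (floorRecip α)
  pd≤ceilDiv {n} H noIso pd =
    let D , domD , ∣D∣≤h = ore {H = H} noIso in Dominating⇒pd≤ H C domD (≤-trans ∣D∣≤h h≤mC) pd
    where
    open ≤-Reasoning
    m = floorRecip α
    C = ceilDiv (⌊ n /2⌋ + 2) m
    h≤mC : ⌊ n /2⌋ ≤ m * C
    h≤mC = begin
      ⌊ n /2⌋         ≤⟨ m≤m+n ⌊ n /2⌋ 2 ⟩
      ⌊ n /2⌋ + 2     ≤⟨ a≤ceilDiv[a,m]*m (⌊ n /2⌋ + 2) (1≤floorRecip α 0<α α≤1) ⟩
      C * m           ≡⟨ *-comm C m ⟩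
      m * C           ∎

  pd≤1 : ∀ {n} (H : Graph n) {k} v → 2 ≤ floorRecip α → n ≤ ∣ N[ ⁅ v ⁆ ] H ∣ + ∣ N[ ⁅ v ⁆ ] H ∣ →
         IsPD α H k → k ≤ 1
  pd≤1 {n} H v 2≤m n≤b+b pd = ≤-trans (proj₂ pd ⁅ v ⁆ (n≤floorRecip*∣N[S]∣⇒IsPartialDom H ⁅ v ⁆ (begin
    n                               ≤⟨ n≤b+b ⟩
    b + b                           ≡⟨ cong (b +_) (+-identityʳ b) ⟨
    2 * b                           ≤⟨ *-monoˡ-≤ b 2≤m ⟩
    floorRecip α * b                ∎))) (≤-reflexive (∣⁅x⁆∣≡1 v))
    where
    open ≤-Reasoning
    b = ∣ N[ ⁅ v ⁆ ] H ∣

  pd≤1⊎pd-complement≤1 : ∀ {n} (G : Graph n) {k₁ k₂} → 2 ≤ floorRecip α →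
                         IsPD α G k₁ → IsPD α (complement G) k₂ → k₁ ≤ 1 ⊎ k₂ ≤ 1
  pd≤1⊎pd-complement≤1 {zero} G _ pd₁ _ = inj₁ (≤-trans (pd≤∣Dominating∣ G ∅ pd₁ (λ ())) z≤n)
  pd≤1⊎pd-complement≤1 {suc n} G 2≤m pd₁ pd₂ =
    Data.Sum.map (λ b≤a → pd≤1 G zero 2≤m (≤-trans n≤a+b (+-monoʳ-≤ a b≤a)) pd₁)
                 (λ a≤b → pd≤1 (complement G) zero 2≤m (≤-trans n≤a+b (+-monoˡ-≤ b a≤b)) pd₂)
                 (≤-total b a)
    where
    a = ∣ N[ ⁅ zero ⁆ ] G ∣
    b = ∣ N[ ⁅ zero ⁆ ] (complement G) ∣
    n≤a+b = n≤∣N[v]∣+∣N[v]-complement∣ G zero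

  pd+pd-complement≤ceilDiv+1 : ∀ {n} (G : Graph n) {k₁ k₂} → 2 ≤ floorRecip α →
    HasNoIsolatedVertex G → HasNoIsolatedVertex (complement G) →
    IsPD α G k₁ → IsPD α (complement G) k₂ → k₁ + k₂ ≤ ceilDiv (⌊ n /2⌋ + 2) (floorRecip α) + 1
  pd+pd-complement≤ceilDiv+1 G 2≤m noG noḠ pd₁ pd₂ =
    [ (λ k₁≤1 → ≤-trans (+-mono-≤ k₁≤1 (pd≤ceilDiv (complement G) noḠ pd₂)) (≤-reflexive (+-comm 1 _)))
    , (λ k₂≤1 → +-mono-≤ (pd≤ceilDiv G noG pd₁) k₂≤1)
    ]′ (pd≤1⊎pd-complement≤1 G 2≤m pd₁ pd₂)

mainTheorem16 : (n : ℕ) (G : Graph n) → HasNoIsolatedVertex G → HasNoIsolatedVertex (complement G)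
    → (α : ℚ) → 0ℚ Data.Rational.< α → α Data.Rational.≤ 1ℚ
    → (k₁ k₂ : ℕ) → IsPD α G k₁ → IsPD α (complement G) k₂
    → k₁ + k₂ ≤ ceilDiv (⌊ n /2⌋ + 2) (floorRecip α) + 1
mainTheorem16 n G noG noḠ α 0<α α≤1 k₁ k₂ pd₁ pd₂ =
  [ (λ 2≤m → pd+pd-complement≤ceilDiv+1 0<α α≤1 G 2≤m noG noḠ pd₁ pd₂)
  , (λ 1≡m → begin
      k₁ + k₂                                   ≤⟨ pd+pd-complement≤⌊n/2⌋+3 0<α α≤1 G noG noḠ pd₁ pd₂ ⟩
      ⌊ n /2⌋ + 2 + 1                           ≡⟨ cong (_+ 1) (ceilDiv[a,1]≡a (⌊ n /2⌋ + 2)) ⟨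
      ceilDiv (⌊ n /2⌋ + 2) 1 + 1               ≡⟨ cong (λ m → ceilDiv (⌊ n /2⌋ + 2) m + 1) 1≡m ⟩
      ceilDiv (⌊ n /2⌋ + 2) (floorRecip α) + 1  ∎)
  ]′ (m≤n⇒m<n∨m≡n (1≤floorRecip α 0<α α≤1))
  where open ≤-Reasoning
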